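{- Let $G$ be a connected graph on $n$ vertices with $2\leq n\leq 7$. If $\psi_{n-1}(G)=2$, then $\psi_n(G)=1$.
   Context: All graphs are finite and simple. For a graph $G=(V,E)$ and a positive integer $k$, a $k$-path vertex cover of $G$ is a set $S\subseteq V$ such that every path on $k$ vertices in $G$ contains at least one vertex of $S$, and $\psi_k(G)$ is the minimum cardinality of such a set. -}

module Defs where

open import Data.Nat using (ℕ; zero; suc; _≤_)
open import Data.Fin using (Fin; zero; suc; toℕ)
open import Data.Fin.Subset using (Subset; _∈_; ∣_∣)
open import Data.Bool using (Bool; true; false)
open import Data.Product using (∃; Σ; _×_)
open import Relation.Binary.PropositionalEquality using (_≡_)
open import Function.Definitions using (Injective)

record Graph (n : ℕ) : Set where
  field
    adj   : Fin n → Fin n → Bool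
    sym   : ∀ u v → adj u v ≡ adj v u
    irrefl : ∀ v → adj v v ≡ false

open Graph public

Adj : ∀ {n} → Graph n → Fin n → Fin n → Set
Adj G u v = adj G u v ≡ true

data Walk {n : ℕ} (G : Graph n) : Fin n → Fin n → Set where
  here : ∀ {v} → Walk G v v
  step : ∀ {u w v} → Adj G u w → Walk G w v → Walk G u v

Connected : ∀ {n} → Graph n → Set
Connected {n} G = (u v : Fin n) → Walk G u v

record Path {n : ℕ} (G : Graph n) (k : ℕ) : Set where
  field
    vert     : Fin k → Fin n
    distinct : Injective _≡_ _≡_ vert
    consec   : ∀ (i : Fin k) (j : Fin k) → toℕ j ≡ suc (toℕ i) → Adj G (vert i) (vert j)

open Path public

IsKPathCover : ∀ {n} → Graph n → ℕ → Subset n → Set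
IsKPathCover G k S = (P : Path G k) → ∃ λ i → vert P i ∈ S

Psi : ∀ {n} → Graph n → ℕ → ℕ → Set
Psi {n} G k m =
  (Σ (Subset n) λ S → IsKPathCover G k S × ∣ S ∣ ≡ m)
  × ((S : Subset n) → IsKPathCover G k S → m ≤ ∣ S ∣)

module Submission where

-- Let G be connected on n = k + 2 vertices, n ≤ 7, with ψ_{n-1}(G) = 2.  The single vertex
-- {0} meets every path on n vertices (such a path visits all vertices), so ψ_n(G) = 1 as
-- soon as G has a Hamiltonian path.  Suppose it has none.  Since no single vertex is an
-- (n-1)-path cover, every vertex v is avoided by a path on the n-1 other vertices.
--   * If Q avoids a, every neighbour of a on Q sits at an interior position of Q, and two
--     distinct such neighbours are at distance ≥ 2 along Q: otherwise inserting a into Q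
--     would give a Hamiltonian path.
--   * By connectivity a has a neighbour x, necessarily on Q.  Take R avoiding x.  Then a
--     lies on R, and (applying the first point to R and x) at an interior position; its two
--     R-neighbours together with x are three distinct neighbours of a on Q.
--   * Three interior positions at mutual distance ≥ 2 need n - 1 ≥ 7 vertices on Q.

open import Defs hiding (sym)
open import Data.Nat using (ℕ; zero; suc; _+_; _≤_; _<_; _∸_; _≤?_; s≤s)
open import Data.Nat.Properties
  using (<-cmp; ≤∧≢⇒<; ≤-refl; ≤-trans; +-monoʳ-≤; n≢0⇒n>0; 1+n≰n; <⇒≢; n≤1+n; suc-injective)
open import Data.Fin using (Fin; zero; suc; toℕ; punchOut; fromℕ; fromℕ<; inject₁; _≟_)
open import Data.Fin.Properties
  using (any?; punchOut-injective; injective⇒≤; toℕ-injective; toℕ<n; toℕ-fromℕ; toℕ-fromℕ<; toℕ-inject₁)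
open import Data.Fin.Subset using (Subset; _∈_; ∣_∣; ⁅_⁆; _⊆_)
open import Data.Fin.Subset.Properties using (x∈⁅x⁆; x∈⁅y⁆⇒x≡y; ∣⁅x⁆∣≡1; p⊆q⇒∣p∣≤∣q∣)
open import Data.Product using (∃; ∃₂; _×_; _,_; proj₂)
open import Data.Sum using (_⊎_; inj₁; inj₂)
open import Data.Empty using (⊥-elim)
open import Function using (_∘_)
open import Function.Definitions using (Injective)
open import Relation.Binary.Definitions using (tri<; tri≈; tri>)
open import Relation.Binary.PropositionalEquality using (_≡_; _≢_; refl; sym; trans; cong; subst)
open import Relation.Nullary using (¬_; Dec; yes; no; contradiction)
open import Relation.Nullary.Decidable using (decidable-stable)

Avoids : ∀ {n k} {G : Graph n} → Path G k → Fin n → Set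
Avoids P v = ∀ i → vert P i ≢ v

-- Some path on all vertices but v avoids v.  It is double negated: this is what a lower
-- bound on the size of covers provides constructively, and it suffices for a contradiction.
Avoidable : ∀ {n} (G : Graph (suc n)) → Fin (suc n) → Set
Avoidable {n} G v = ¬ ((Q : Path G n) → ¬ Avoids Q v)

adj-sym : ∀ {n} (G : Graph n) {u v} → Adj G u v → Adj G v u
adj-sym G {u} {v} uv = trans (Graph.sym G v u) uv

adj⇒≢ : ∀ {n} (G : Graph n) {u v} → Adj G u v → u ≢ v
adj⇒≢ G {u} uu refl with trans (sym uu) (irrefl G u)
... | ()

hits : ∀ {k n} (f : Fin k → Fin n) (y : Fin n) → ¬ (∀ i → f i ≢ y) → ∃ λ i → f i ≡ y
hits f y notMissed with any? (λ i → f i ≟ y)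
... | yes found = found
... | no none = contradiction (λ i fi≡y → none (i , fi≡y)) notMissed

-- An injection into Fin (suc n) missing a point y factors injectively through Fin n.
missing⇒≤ : ∀ {k n} {f : Fin k → Fin (suc n)} {y} →
  Injective _≡_ _≡_ f → (∀ i → f i ≢ y) → k ≤ n
missing⇒≤ {f = f} f-inj missY =
  injective⇒≤ (λ {i} {j} e → f-inj (punchOut-injective (missY i ∘ sym) (missY j ∘ sym) e))

missingTwo⇒≤ : ∀ {k n} {f : Fin k → Fin (suc (suc n))} {a y} →
  Injective _≡_ _≡_ f → y ≢ a → (∀ i → f i ≢ a) → (∀ i → f i ≢ y) → k ≤ n
missingTwo⇒≤ {f = f} {a} {y} f-inj y≢a missA missY = missing⇒≤ {f = squeeze} squeeze-inj squeeze-miss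
  where
  squeeze : Fin _ → Fin _
  squeeze i = punchOut {i = a} (missA i ∘ sym)
  squeeze-inj : Injective _≡_ _≡_ squeeze
  squeeze-inj {i} {j} e = f-inj (punchOut-injective (missA i ∘ sym) (missA j ∘ sym) e)
  squeeze-miss : ∀ i → squeeze i ≢ punchOut {i = a} (y≢a ∘ sym)
  squeeze-miss i e = missY i (punchOut-injective (missA i ∘ sym) (y≢a ∘ sym) e)

hamiltonian-visits : ∀ {n} {G : Graph n} (P : Path G n) (y : Fin n) → ∃ λ i → vert P i ≡ y
hamiltonian-visits {suc n} P y = hits (vert P) y (1+n≰n ∘ missing⇒≤ (distinct P))

avoiding-visits : ∀ {k} {G : Graph (suc (suc k))} (P : Path G (suc k)) {a} → Avoids P a →
  (y : Fin (suc (suc k))) → y ≢ a → ∃ λ i → vert P i ≡ y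
avoiding-visits P avoidsA y y≢a = hits (vert P) y (1+n≰n ∘ missingTwo⇒≤ (distinct P) y≢a avoidsA)

toℕ-punchOut-below : ∀ {n} {i j : Fin (suc n)} (i≢j : i ≢ j) → toℕ j < toℕ i →
  toℕ (punchOut i≢j) ≡ toℕ j
toℕ-punchOut-below {zero}  {suc ()}
toℕ-punchOut-below {suc n} {suc i} {zero}  i≢j _         = refl
toℕ-punchOut-below {suc n} {suc i} {suc j} i≢j (s≤s j<i) =
  cong suc (toℕ-punchOut-below (i≢j ∘ cong suc) j<i)

toℕ-punchOut-above : ∀ {n} {i j : Fin (suc n)} (i≢j : i ≢ j) → toℕ i < toℕ j →
  suc (toℕ (punchOut i≢j)) ≡ toℕ j
toℕ-punchOut-above {_}     {zero}  {suc j} i≢j _         = refl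
toℕ-punchOut-above {zero}  {suc ()}
toℕ-punchOut-above {suc n} {suc i} {suc j} i≢j (s≤s i<j) =
  cong suc (toℕ-punchOut-above (i≢j ∘ cong suc) i<j)

insert : ∀ {n m} {G : Graph n} (P : Path G m) {x : Fin n} → Avoids P x → (t : Fin (suc m)) →
  (∀ i → suc (toℕ i) ≡ toℕ t → Adj G (vert P i) x) →
  (∀ i → toℕ i ≡ toℕ t → Adj G x (vert P i)) → Path G (suc m)
insert {n} {m} {G} P {x} avoidsX t before after =
  record { vert = new ; distinct = new-injective ; consec = new-consec }
  where
  place : (j : Fin (suc m)) → Dec (t ≡ j) → Fin n
  place j (yes _)  = x
  place j (no t≢j) = vert P (punchOut t≢j)

  new : Fin (suc m) → Fin n
  new j = place j (t ≟ j)

  new-injective : Injective _≡_ _≡_ new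
  new-injective {j} {j'} e with t ≟ j | t ≟ j'
  ... | yes t≡j | yes t≡j' = trans (sym t≡j) t≡j'
  ... | yes _   | no _     = ⊥-elim (avoidsX _ (sym e))
  ... | no _    | yes _    = ⊥-elim (avoidsX _ e)
  ... | no t≢j  | no t≢j'  = punchOut-injective t≢j t≢j' (distinct P e)

  new-consec : ∀ j j' → toℕ j' ≡ suc (toℕ j) → Adj G (new j) (new j')
  new-consec j j' j'≡j+1 with t ≟ j | t ≟ j'
  ... | yes refl | yes refl = ⊥-elim (<⇒≢ ≤-refl j'≡j+1)
  ... | yes refl | no t≢j'  =
    after (punchOut t≢j') (suc-injective (trans (toℕ-punchOut-above t≢j' t<j') j'≡j+1))
    where
    t<j' : toℕ t < toℕ j'
    t<j' = subst (toℕ t <_) (sym j'≡j+1) ≤-refl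
  ... | no t≢j   | yes refl =
    before (punchOut t≢j) (trans (cong suc (toℕ-punchOut-below t≢j j<t)) (sym j'≡j+1))
    where
    j<t : toℕ j < toℕ t
    j<t = subst (suc (toℕ j) ≤_) (sym j'≡j+1) ≤-refl
  ... | no t≢j   | no t≢j' with <-cmp (toℕ j) (toℕ t)
  ...   | tri≈ _ j≡t _ = ⊥-elim (t≢j (sym (toℕ-injective j≡t)))
  ...   | tri< j<t _ _ = consec P (punchOut t≢j) (punchOut t≢j')
          (trans (toℕ-punchOut-below t≢j' j'<t)
                 (trans j'≡j+1 (cong suc (sym (toℕ-punchOut-below t≢j j<t)))))
    where
    j'<t : toℕ j' < toℕ t
    j'<t = ≤∧≢⇒< (subst (_≤ toℕ t) (sym j'≡j+1) j<t) (t≢j' ∘ sym ∘ toℕ-injective)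
  ...   | tri> _ _ t<j = consec P (punchOut t≢j) (punchOut t≢j')
          (suc-injective (trans (toℕ-punchOut-above t≢j' t<j')
                                (trans j'≡j+1 (cong suc (sym (toℕ-punchOut-above t≢j t<j))))))
    where
    t<j' : toℕ t < toℕ j'
    t<j' = subst (toℕ t <_) (sym j'≡j+1) (≤-trans t<j (n≤1+n _))

prepend : ∀ {n m} {G : Graph n} (P : Path G m) {x : Fin n} → Avoids P x →
  ∀ {p} → Adj G x (vert P p) → toℕ p ≡ 0 → Path G (suc m)
prepend {G = G} P {x} avoidsX {p} xp p-first = insert P avoidsX zero (λ i ())
  (λ i i-first → subst (λ q → Adj G x (vert P q)) (toℕ-injective (trans p-first (sym i-first))) xp)

append : ∀ {n m} {G : Graph n} (P : Path G m) {x : Fin n} → Avoids P x →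
  ∀ {p} → Adj G (vert P p) x → suc (toℕ p) ≡ m → Path G (suc m)
append {m = m} {G} P {x} avoidsX {p} px p-last = insert P avoidsX (fromℕ m)
  (λ i i-last → subst (λ q → Adj G (vert P q) x)
     (toℕ-injective (suc-injective (trans p-last (sym (trans i-last (toℕ-fromℕ m)))))) px)
  (λ i i≡m → ⊥-elim (<⇒≢ (toℕ<n i) (trans i≡m (toℕ-fromℕ m))))

insertBetween : ∀ {n m} {G : Graph n} (P : Path G m) {x : Fin n} → Avoids P x →
  ∀ {p q} → Adj G (vert P p) x → Adj G x (vert P q) → toℕ q ≡ suc (toℕ p) → Path G (suc m)
insertBetween {G = G} P {x} avoidsX {p} {q} px xq q≡p+1 = insert P avoidsX (inject₁ q)
  (λ i i+1≡q → subst (λ r → Adj G (vert P r) x)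
     (toℕ-injective (sym (suc-injective (trans (trans i+1≡q (toℕ-inject₁ q)) q≡p+1)))) px)
  (λ i i≡q → subst (λ r → Adj G x (vert P r)) (toℕ-injective (sym (trans i≡q (toℕ-inject₁ q)))) xq)

Interior : ℕ → ℕ → Set
Interior m p = 1 ≤ p × 2 + p ≤ m

Apart : ℕ → ℕ → Set
Apart p q = 2 + p ≤ q ⊎ 2 + q ≤ p

increasing : ∀ {m p q r} → Interior m p → 2 + p ≤ q → 2 + q ≤ r → Interior m r → 7 ≤ m
increasing (1≤p , _) p≪q q≪r (_ , r<m) =
  ≤-trans (+-monoʳ-≤ 6 1≤p) (≤-trans (+-monoʳ-≤ 4 p≪q) (≤-trans (+-monoʳ-≤ 2 q≪r) r<m))

three-apart⇒7≤ : ∀ {m p q r} → Interior m p → Interior m q → Interior m r →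
  Apart p q → Apart q r → Apart p r → 7 ≤ m
three-apart⇒7≤ ip iq ir (inj₁ p≪q) (inj₁ q≪r) _          = increasing ip p≪q q≪r ir
three-apart⇒7≤ ip iq ir (inj₁ p≪q) (inj₂ r≪q) (inj₁ p≪r) = increasing ip p≪r r≪q iq
three-apart⇒7≤ ip iq ir (inj₁ p≪q) (inj₂ r≪q) (inj₂ r≪p) = increasing ir r≪p p≪q iq
three-apart⇒7≤ ip iq ir (inj₂ q≪p) (inj₁ q≪r) (inj₁ p≪r) = increasing iq q≪p p≪r ir
three-apart⇒7≤ ip iq ir (inj₂ q≪p) (inj₁ q≪r) (inj₂ r≪p) = increasing iq q≪r r≪p ip
three-apart⇒7≤ ip iq ir (inj₂ q≪p) (inj₂ r≪q) _          = increasing ir r≪q q≪p ip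

interior-neighbours : ∀ {n m} {G : Graph n} (P : Path G m) (j : Fin m) → Interior m (toℕ j) →
  ∃₂ λ j₁ j₂ → j₁ ≢ j₂ × Adj G (vert P j₁) (vert P j) × Adj G (vert P j) (vert P j₂)
interior-neighbours P (suc j) (_ , j+1<m) =
  inject₁ j , fromℕ< j+1<m , j-1≢j+1 ,
  consec P (inject₁ j) (suc j) (cong suc (sym (toℕ-inject₁ j))) ,
  consec P (suc j) (fromℕ< j+1<m) (toℕ-fromℕ< j+1<m)
  where
  j-1≢j+1 : inject₁ j ≢ fromℕ< j+1<m
  j-1≢j+1 e = <⇒≢ (s≤s (n≤1+n _))
    (trans (sym (toℕ-inject₁ j)) (trans (cong toℕ e) (toℕ-fromℕ< j+1<m)))

module WithoutHamiltonianPath {k : ℕ} (G : Graph (suc (suc k))) (noHam : ¬ Path G (suc (suc k))) where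

  module _ (Q : Path G (suc k)) {a : Fin (suc (suc k))} (avoidsA : Avoids Q a) where

    -- A neighbour of a on Q is not an endpoint of Q: a could be attached there.
    neighbour-interior : ∀ {p} → Adj G a (vert Q p) → Interior (suc k) (toℕ p)
    neighbour-interior {p} ap = n≢0⇒n>0 notFirst , ≤∧≢⇒< (toℕ<n p) notLast
      where
      notFirst : toℕ p ≢ 0
      notFirst = noHam ∘ prepend Q avoidsA ap
      notLast : suc (toℕ p) ≢ suc k
      notLast = noHam ∘ append Q avoidsA (adj-sym G ap)

    -- Two neighbours of a are not consecutive on Q: a could be inserted between them.
    not-consecutive : ∀ {p q} → Adj G a (vert Q p) → Adj G a (vert Q q) → suc (toℕ p) ≢ toℕ q
    not-consecutive ap aq p+1≡q = noHam (insertBetween Q avoidsA (adj-sym G ap) aq (sym p+1≡q))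

    neighbours-apart : ∀ {p q} → Adj G a (vert Q p) → Adj G a (vert Q q) → p ≢ q →
      Apart (toℕ p) (toℕ q)
    neighbours-apart {p} {q} ap aq p≢q with <-cmp (toℕ p) (toℕ q)
    ... | tri< p<q _ _ = inj₁ (≤∧≢⇒< p<q (not-consecutive ap aq))
    ... | tri≈ _ p≡q _ = ⊥-elim (p≢q (toℕ-injective p≡q))
    ... | tri> _ _ q<p = inj₂ (≤∧≢⇒< q<p (not-consecutive aq ap))

    three-neighbours : ∀ {p q r} → p ≢ q → q ≢ r → p ≢ r →
      Adj G a (vert Q p) → Adj G a (vert Q q) → Adj G a (vert Q r) → 7 ≤ suc k
    three-neighbours p≢q q≢r p≢r ap aq ar =
      three-apart⇒7≤ (neighbour-interior ap) (neighbour-interior aq) (neighbour-interior ar)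
        (neighbours-apart ap aq p≢q) (neighbours-apart aq ar q≢r) (neighbours-apart ap ar p≢r)

    neighbour-on-path : ∀ {y} → Adj G a y → ∃ λ p → vert Q p ≡ y × Adj G a (vert Q p)
    neighbour-on-path {y} ay with avoiding-visits Q avoidsA y (adj⇒≢ G ay ∘ sym)
    ... | p , p↦y = p , p↦y , subst (Adj G a) (sym p↦y) ay

  two-neighbours-on : (R : Path G (suc k)) {a x : Fin (suc (suc k))} → Avoids R x → Adj G a x →
    ∃₂ λ j₁ j₂ → j₁ ≢ j₂ × Adj G a (vert R j₁) × Adj G a (vert R j₂)
  two-neighbours-on R {a} {x} avoidsX ax with avoiding-visits R avoidsX a (adj⇒≢ G ax)
  ... | j , j↦a with interior-neighbours R j (neighbour-interior R avoidsX x~j)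
    where
    x~j : Adj G x (vert R j)
    x~j = subst (Adj G x) (sym j↦a) (adj-sym G ax)
  ... | j₁ , j₂ , j₁≢j₂ , j₁~j , j~j₂ =
    j₁ , j₂ , j₁≢j₂ ,
    adj-sym G (subst (Adj G (vert R j₁)) j↦a j₁~j) , subst (λ v → Adj G v (vert R j₂)) j↦a j~j₂

  -- Q avoids a, x = Q(i) is a neighbour of a and R avoids x: the two R-neighbours of a
  -- and x are three neighbours of a on Q.
  exchange : (Q : Path G (suc k)) {a : Fin (suc (suc k))} → Avoids Q a → ∀ {i} → Adj G a (vert Q i) →
    (R : Path G (suc k)) → Avoids R (vert Q i) → 7 ≤ suc k
  exchange Q {a} avoidsA {i} ax R avoidsX with two-neighbours-on R avoidsX ax
  ... | j₁ , j₂ , j₁≢j₂ , a~j₁ , a~j₂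
    with neighbour-on-path Q avoidsA a~j₁ | neighbour-on-path Q avoidsA a~j₂
  ... | p₁ , p₁↦j₁ , a~p₁ | p₂ , p₂↦j₂ , a~p₂ = three-neighbours Q avoidsA i≢p₁ p₁≢p₂ i≢p₂ ax a~p₁ a~p₂
    where
    i≢p₁ : i ≢ p₁
    i≢p₁ i≡p₁ = avoidsX j₁ (trans (sym p₁↦j₁) (cong (vert Q) (sym i≡p₁)))
    i≢p₂ : i ≢ p₂
    i≢p₂ i≡p₂ = avoidsX j₂ (trans (sym p₂↦j₂) (cong (vert Q) (sym i≡p₂)))
    p₁≢p₂ : p₁ ≢ p₂
    p₁≢p₂ p₁≡p₂ = j₁≢j₂ (distinct R (trans (sym p₁↦j₁) (trans (cong (vert Q) p₁≡p₂) p₂↦j₂)))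

  eight-vertices : Connected G → (∀ v → Avoidable G v) → 7 ≤ suc k
  eight-vertices conn avoidable = decidable-stable (7 ≤? suc k) λ small →
    avoidable zero λ Q avoids0 →
      let (i , _ , 0~i) = neighbour-on-path Q avoids0 (proj₂ edge-at-0)
      in avoidable (vert Q i) λ R avoidsX → small (exchange Q avoids0 0~i R avoidsX)
    where
    edge-at-0 : ∃ (Adj G zero)
    edge-at-0 with conn zero (suc zero)
    ... | step 0~w _ = _ , 0~w

cover-nonempty : ∀ {n k} {G : Graph n} {S : Subset n} → IsKPathCover G k S → Path G k → 1 ≤ ∣ S ∣
cover-nonempty {S = S} cover P with cover P
... | i , i∈S = subst (_≤ ∣ S ∣) (∣⁅x⁆∣≡1 (vert P i)) (p⊆q⇒∣p∣≤∣q∣ singleton⊆S)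
  where
  singleton⊆S : ⁅ vert P i ⁆ ⊆ S
  singleton⊆S y∈ = subst (_∈ S) (sym (x∈⁅y⁆⇒x≡y _ y∈)) i∈S

singleton-cover : ∀ {n k} {G : Graph n} (v : Fin n) → ((P : Path G k) → ¬ Avoids P v) →
  IsKPathCover G k ⁅ v ⁆
singleton-cover v noneAvoid P with hits (vert P) v (noneAvoid P)
... | i , i↦v = i , subst (_∈ ⁅ v ⁆) (sym i↦v) (x∈⁅x⁆ v)

hamiltonian-cover : ∀ {n} {G : Graph n} (v : Fin n) → IsKPathCover G n ⁅ v ⁆
hamiltonian-cover v P with hamiltonian-visits P v
... | i , i↦v = i , subst (_∈ ⁅ v ⁆) (sym i↦v) (x∈⁅x⁆ v)

mainTheorem12 : (n : ℕ) → 2 ≤ n → n ≤ 7 → (G : Graph n) → Connected G →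
    Psi G (n ∸ 1) 2 → Psi G n 1
mainTheorem12 zero          ()        _            _ _    _
mainTheorem12 (suc zero)    (s≤s ())  _            _ _    _
mainTheorem12 (suc (suc k)) _         (s≤s k+1≤6)  G conn (_ , atLeast2) =
  (⁅ zero ⁆ , hamiltonian-cover zero , ∣⁅x⁆∣≡1 {suc (suc k)} zero) , atLeast1
  where
  avoidable : ∀ v → Avoidable G v
  avoidable v noneAvoid =
    1+n≰n (subst (2 ≤_) (∣⁅x⁆∣≡1 v) (atLeast2 ⁅ v ⁆ (singleton-cover v noneAvoid)))

  -- an empty cover would mean no Hamiltonian path, forcing n ≥ 8
  atLeast1 : (S : Subset (suc (suc k))) → IsKPathCover G (suc (suc k)) S → 1 ≤ ∣ S ∣
  atLeast1 S cover = decidable-stable (1 ≤? ∣ S ∣) λ empty →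
    let open WithoutHamiltonianPath G (empty ∘ cover-nonempty cover)
    in 1+n≰n (≤-trans (eight-vertices conn avoidable) k+1≤6)
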